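{- Let $G$ be a finite generalized dihedral group and let $H$ be a nontrivial subgroup of $G$. Then: (a) $H$ is a perfect code of $G$ if and only if $H$ is an $(a,b)$-regular set of $G$ for every pair of integers $a,b$ with $0\leqslant a\leqslant |H|-1$, $0\leqslant b\leqslant |H|$, and $a$ even when $|H|$ is odd; (b) $H$ is a total perfect code of $G$ if and only if $H$ is an $(a,b)$-regular set of $G$ for every pair of integers $a,b$ with $0\leqslant a\leqslant |H|-1$ and $0\leqslant b\leqslant |H|$.
   Context: All groups are finite and all graphs are finite, undirected and simple; $e$ denotes the identity. For a group $G$ and an inverse-closed subset $S\subseteq G\setminus\{e\}$, the Cayley graph $\mathrm{Cay}(G,S)$ has vertex set $G$, with $x,y$ adjacent iff $yx^{ -1}\in S$. For a graph $\Gamma$ with vertex set $V$ and nonnegative integers $a,b$, an $(a,b)$-regular set in $\Gamma$ is a nonempty proper subset $C\subset V$ such that every vertex of $C$ has exactly $a$ neighbours in $C$ and every vertex of $V\setminus C$ has exactly $b$ neighbours in $C$. A $(0,1)$-regular set is a perfect code and a $(1,1)$-regular set is a total perfect code. A subset $C$ of a group $G$ is an $(a,b)$-regular set (resp. perfect code, total perfect code) of $G$ if it is an $(a,b)$-regular set (resp. perfect code, total perfect code) in some Cayley graph of $G$. A group $G$ is a generalized dihedral group (with respect to $A$) if $A$ is an abelian subgroup of $G$ and there is $y\in G$ with $G=\langle A,y\mid y^2=e,\ y^{ -1}xy=x^{ -1}\ \forall x\in A\rangle$. -}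

module Defs where

open import Data.Nat using (ℕ; _<_; _≤_)
open import Data.Nat.Divisibility using (_∣_)
open import Data.Fin using (Fin)
open import Data.Fin.Subset using (Subset; _∈_; _∉_; _∩_; ∣_∣; inside; outside)
open import Data.Vec using (tabulate; lookup)
open import Data.Product using (Σ; ∃; _×_)
open import Data.Sum using (_⊎_)
open import Relation.Nullary using (¬_)
open import Relation.Binary.PropositionalEquality using (_≡_; _≢_)
open import Algebra.Structures using (IsGroup)
open import Function.Bundles using (_⇔_)

-- A finite group, presented (up to isomorphism) with carrier Fin order
-- and propositional equality.
record FinGroup : Set where
  infixl 7 _∙_
  infix 8 _⁻¹
  field
    order   : ℕ
    _∙_     : Fin order → Fin order → Fin order
    ε       : Fin order
    _⁻¹     : Fin order → Fin order
    isGroup : IsGroup _≡_ _∙_ ε _⁻¹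

module _ (G : FinGroup) where
  open FinGroup G

  IsSubgroup : Subset order → Set
  IsSubgroup H = (ε ∈ H)
               × (∀ x y → x ∈ H → y ∈ H → (x ∙ y) ∈ H)
               × (∀ x → x ∈ H → (x ⁻¹) ∈ H)

  IsAbelianSubgroup : Subset order → Set
  IsAbelianSubgroup A = IsSubgroup A × (∀ x y → x ∈ A → y ∈ A → x ∙ y ≡ y ∙ x)

  Nontrivial : Subset order → Set
  Nontrivial H = ∃ λ h → h ∈ H × h ≢ ε

  -- G = ⟨A, y | y² = e, y⁻¹ x y = x⁻¹ (x ∈ A)⟩, i.e. G = A ⋊ ⟨y⟩ with |G:A| = 2
  IsGeneralizedDihedralWrt : Subset order → Set
  IsGeneralizedDihedralWrt A =
    IsAbelianSubgroup A ×
    (∃ λ y → (y ∉ A)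
           × (y ∙ y ≡ ε)
           × (∀ x → x ∈ A → y ⁻¹ ∙ x ∙ y ≡ x ⁻¹)
           × (∀ g → g ∈ A ⊎ (∃ λ a → a ∈ A × g ≡ a ∙ y)))

  IsGeneralizedDihedral : Set
  IsGeneralizedDihedral = ∃ λ A → IsGeneralizedDihedralWrt A

  IsConnectionSet : Subset order → Set
  IsConnectionSet S = (ε ∉ S) × (∀ s → s ∈ S → (s ⁻¹) ∈ S)

  -- number of neighbours of x lying in C in Cay(G,S)
  -- (c adjacent to x iff c x⁻¹ ∈ S)
  nbrsIn : Subset order → Subset order → Fin order → ℕ
  nbrsIn S C x = ∣ C ∩ tabulate (λ c → lookup S (c ∙ x ⁻¹)) ∣

  IsRegularSetIn : Subset order → ℕ → ℕ → Subset order → Set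
  IsRegularSetIn S a b C =
    (∃ λ c → c ∈ C) × (∃ λ v → v ∉ C)
    × (∀ x → x ∈ C → nbrsIn S C x ≡ a)
    × (∀ x → x ∉ C → nbrsIn S C x ≡ b)

  IsRegularSetOf : ℕ → ℕ → Subset order → Set
  IsRegularSetOf a b C = ∃ λ S → IsConnectionSet S × IsRegularSetIn S a b C

  IsPerfectCodeOf : Subset order → Set
  IsPerfectCodeOf = IsRegularSetOf 0 1

  IsTotalPerfectCodeOf : Subset order → Set
  IsTotalPerfectCodeOf = IsRegularSetOf 1 1

-- An (a₀,1)-regular subgroup H of G (a perfect or total perfect code) yields the
-- inverse-closed set T = S ─ H containing exactly one representative of every right
-- coset Hg ≠ H. A connection set making H (a,b)-regular is then assembled as S₁ ∪ S₂:
-- an inverse-closed S₁ ⊆ H - ε of size a gives every vertex of H exactly a neighbours in H,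
-- and an inverse-closed S₂ meeting every coset Hg ≠ H in exactly b elements gives every
-- outside vertex b neighbours in H. For S₂ take B ⋆ T with B ⊆ H ∩ A inverse-closed of size
-- b: in a generalized dihedral group conjugation maps each element of A to itself or to its
-- inverse, which is exactly what makes B ⋆ T inverse-closed. If b > ∣H ∩ A∣, then H ⊈ A,
-- so ∣H∣ = 2∣H ∩ A∣ and the complement of such a set for ∣H∣ ∸ b works.
-- Inversion pairs off the elements of an inverse-closed set that are not involutions, so
-- inverse-closed subsets of every even size exist, and of every size once an involution is
-- available: in H ∩ A the identity, in H - ε an involution, which exists when ∣H∣ is even
-- and when H is a total perfect code.

module Submission where

open import Defs
open import Data.Nat using (ℕ; _<_; _≤_)
open import Data.Nat.Divisibility using (_∣_)
open import Data.Fin.Subset using (Subset; ∣_∣)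
open import Data.Product using (_×_)
open import Relation.Nullary using (¬_)
open import Function.Bundles using (_⇔_)

open import Algebra.Bundles using (Group)
import Algebra.Properties.CommutativeMonoid.Sum as Sum
open import Data.Bool using (Bool; true; not; if_then_else_)
open import Data.Bool.Properties using (T-≡)
open import Data.Fin using (Fin; _≟_)
import Data.Fin as Fin
open import Data.Fin.Permutation using (Permutation′; _⟨$⟩ʳ_; permutation)
open import Data.Fin.Properties using (any?)
open import Data.Fin.Subset
  using (_∈_; _∉_; _⊆_; ∁; _∩_; _∪_; _─_; _-_; ⁅_⁆; ⊥; inside; outside; Nonempty)
open import Data.Fin.Subset.Properties
open import Data.Nat using (zero; suc; _+_; _∸_; z≤n; s≤s; z<s)
open import Data.Nat.Divisibility using (_∣?_; _∣0; ∣-refl; ∣1⇒≡1; ∣m∣n⇒∣m+n; ∣m+n∣m⇒∣n)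
open import Data.Nat.Induction using (<-wellFounded)
open import Data.Nat.Properties
  using ( +-suc; +-comm; +-identityʳ; m+n∸m≡n; m∸[m∸n]≡n; ∸-monoʳ-≤; <-trans; <⇒≤; ≤-<-trans
        ; >⇒≢; <⇒≱; ≰⇒>; n≢0⇒n>0; ≤-trans; ≤-antisym; ≤-pred; _≤?_; +-0-commutativeMonoid
        ; module ≤-Reasoning)
open import Data.Product using (∃; _,_; proj₁; proj₂)
open import Data.Sum using (_⊎_; inj₁; inj₂; [_,_]′)
open import Data.Vec using (_∷_; []; tabulate; lookup; here; there)
open import Data.Vec.Properties
  using (lookup∘tabulate; lookup-map; tabulate-∘; tabulate-cong; lookup⇒[]=; []=⇒lookup)
open import Function using (_∘_; id)
open import Function.Bundles using (mk⇔; Equivalence)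
open import Induction.WellFounded using (Acc; acc)
open import Level using (0ℓ)
open import Relation.Binary.PropositionalEquality
  using (_≡_; _≢_; refl; sym; trans; cong; cong₂; subst; module ≡-Reasoning)
open import Relation.Nullary using (contradiction; yes; no; does)
open import Relation.Nullary.Decidable using (_×-dec_; toWitness; isYes≗does; dec-true)
open import Relation.Unary using (Decidable)

private
  variable
    n : ℕ

-- Cardinalities of finite subsets

x∈p─q⁻ : ∀ {x} (p q : Subset n) → x ∈ p ─ q → x ∈ p × x ∉ q
x∈p─q⁻ (inside ∷ p) (outside ∷ q) here = here , λ ()
x∈p─q⁻ {x = Fin.zero} (outside ∷ p) (inside ∷ q) ()
x∈p─q⁻ {x = Fin.zero} (outside ∷ p) (outside ∷ q) ()
x∈p─q⁻ {x = Fin.zero} (inside ∷ p) (inside ∷ q) ()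
x∈p─q⁻ (_ ∷ p) (_ ∷ q) (there x∈p─q) =
  there (proj₁ (x∈p─q⁻ p q x∈p─q)) , λ { (there x∈q) → proj₂ (x∈p─q⁻ p q x∈p─q) x∈q }

∣p∣≡∣p∩q∣+∣p─q∣ : ∀ (p q : Subset n) → ∣ p ∣ ≡ ∣ p ∩ q ∣ + ∣ p ─ q ∣
∣p∣≡∣p∩q∣+∣p─q∣ [] [] = refl
∣p∣≡∣p∩q∣+∣p─q∣ (inside ∷ p) (inside ∷ q) = cong suc (∣p∣≡∣p∩q∣+∣p─q∣ p q)
∣p∣≡∣p∩q∣+∣p─q∣ (inside ∷ p) (outside ∷ q) =
  trans (cong suc (∣p∣≡∣p∩q∣+∣p─q∣ p q)) (sym (+-suc _ _))
∣p∣≡∣p∩q∣+∣p─q∣ (outside ∷ p) (inside ∷ q) = ∣p∣≡∣p∩q∣+∣p─q∣ p q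
∣p∣≡∣p∩q∣+∣p─q∣ (outside ∷ p) (outside ∷ q) = ∣p∣≡∣p∩q∣+∣p─q∣ p q

q⊆p⇒∣p∣≡∣q∣+∣p─q∣ : ∀ {p q : Subset n} → q ⊆ p → ∣ p ∣ ≡ ∣ q ∣ + ∣ p ─ q ∣
q⊆p⇒∣p∣≡∣q∣+∣p─q∣ {p = p} {q} q⊆p = trans (∣p∣≡∣p∩q∣+∣p─q∣ p q)
  (cong (λ r → ∣ r ∣ + ∣ p ─ q ∣) (⊆-antisym (p∩q⊆q p q) (λ x∈q → x∈p∩q⁺ (q⊆p x∈q , x∈q))))

∣p∪q∣≡∣p∣+∣q∣ : ∀ (p q : Subset n) → (∀ {x} → x ∈ p → x ∉ q) → ∣ p ∪ q ∣ ≡ ∣ p ∣ + ∣ q ∣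
∣p∪q∣≡∣p∣+∣q∣ [] [] _ = refl
∣p∪q∣≡∣p∣+∣q∣ (inside ∷ p) (inside ∷ q) disj = contradiction here (disj here)
∣p∪q∣≡∣p∣+∣q∣ (inside ∷ p) (outside ∷ q) disj =
  cong suc (∣p∪q∣≡∣p∣+∣q∣ p q λ x∈p x∈q → disj (there x∈p) (there x∈q))
∣p∪q∣≡∣p∣+∣q∣ (outside ∷ p) (inside ∷ q) disj =
  trans (cong suc (∣p∪q∣≡∣p∣+∣q∣ p q λ x∈p x∈q → disj (there x∈p) (there x∈q))) (sym (+-suc _ _))
∣p∪q∣≡∣p∣+∣q∣ (outside ∷ p) (outside ∷ q) disj =
  ∣p∪q∣≡∣p∣+∣q∣ p q λ x∈p x∈q → disj (there x∈p) (there x∈q)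

p∩∁q≡p─q : ∀ (p q : Subset n) → p ∩ ∁ q ≡ p ─ q
p∩∁q≡p─q p q = ⊆-antisym
  (λ x∈p∩∁q → let x∈p , x∈∁q = x∈p∩q⁻ p (∁ q) x∈p∩∁q in x∈p∧x∉q⇒x∈p─q x∈p (x∈∁p⇒x∉p x∈∁q))
  (λ x∈p─q → let x∈p , x∉q = x∈p─q⁻ p q x∈p─q in x∈p∩q⁺ (x∈p , x∉p⇒x∈∁p x∉q))

∣p∩∁q∣≡∣p∣∸∣p∩q∣ : ∀ (p q : Subset n) → ∣ p ∩ ∁ q ∣ ≡ ∣ p ∣ ∸ ∣ p ∩ q ∣
∣p∩∁q∣≡∣p∣∸∣p∩q∣ p q = begin
  ∣ p ∩ ∁ q ∣                           ≡⟨ cong ∣_∣ (p∩∁q≡p─q p q) ⟩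
  ∣ p ─ q ∣                             ≡⟨ m+n∸m≡n ∣ p ∩ q ∣ ∣ p ─ q ∣ ⟨
  ∣ p ∩ q ∣ + ∣ p ─ q ∣ ∸ ∣ p ∩ q ∣     ≡⟨ cong (_∸ ∣ p ∩ q ∣) (∣p∣≡∣p∩q∣+∣p─q∣ p q) ⟨
  ∣ p ∣ ∸ ∣ p ∩ q ∣                     ∎
  where open ≡-Reasoning

x∈p⇒0<∣p∣ : ∀ {x} {p : Subset n} → x ∈ p → 0 < ∣ p ∣
x∈p⇒0<∣p∣ x∈p = ≤-<-trans z≤n (x∈p⇒∣p-x∣<∣p∣ x∈p)

0<∣p∣⇒Nonempty : ∀ {p : Subset n} → 0 < ∣ p ∣ → Nonempty p
0<∣p∣⇒Nonempty {n} {p} 0<∣p∣ with nonempty? p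
... | yes ne = ne
... | no ¬ne = contradiction (trans (cong ∣_∣ (Empty-unique ¬ne)) (∣⊥∣≡0 n)) (>⇒≢ 0<∣p∣)

x∈p⇒∣p∣≡1+∣p-x∣ : ∀ {x} {p : Subset n} → x ∈ p → ∣ p ∣ ≡ suc ∣ p - x ∣
x∈p⇒∣p∣≡1+∣p-x∣ {x = x} {p} x∈p =
  trans (q⊆p⇒∣p∣≡∣q∣+∣p─q∣ (λ y∈⁅x⁆ → subst (_∈ p) (sym (x∈⁅y⁆⇒x≡y x y∈⁅x⁆)) x∈p))
        (cong (_+ ∣ p - x ∣) (∣⁅x⁆∣≡1 x))

∣p∣≡1⇒x∈p⇒y∈p⇒x≡y : ∀ {x y} {p : Subset n} → ∣ p ∣ ≡ 1 → x ∈ p → y ∈ p → x ≡ y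
∣p∣≡1⇒x∈p⇒y∈p⇒x≡y {x = x} {y} {p} ∣p∣≡1 x∈p y∈p with x ≟ y
... | yes x≡y = x≡y
... | no x≢y = contradiction (subst (∣ p - x ∣ <_) ∣p∣≡1 (x∈p⇒∣p-x∣<∣p∣ x∈p))
                 (<⇒≱ (s≤s (x∈p⇒0<∣p∣ (x∈p∧x≢y⇒x∈p-y y∈p (x≢y ∘ sym)))))

preimage : (Fin n → Fin n) → Subset n → Subset n
preimage f p = tabulate (lookup p ∘ f)

x∈tabulate⇔ : ∀ {x} {f : Fin n → Bool} → x ∈ tabulate f ⇔ f x ≡ true
x∈tabulate⇔ {x = x} {f} = mk⇔
  (λ x∈ → trans (sym (lookup∘tabulate f x)) ([]=⇒lookup x∈))
  (λ fx≡true → lookup⇒[]= x (tabulate f) (trans (lookup∘tabulate f x) fx≡true))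

x∈preimage⇔ : ∀ {x} {f : Fin n → Fin n} {p} → x ∈ preimage f p ⇔ f x ∈ p
x∈preimage⇔ {f = f} {p} = mk⇔
  (λ x∈ → lookup⇒[]= (f _) p (Equivalence.to x∈tabulate⇔ x∈))
  (λ fx∈ → Equivalence.from x∈tabulate⇔ ([]=⇒lookup fx∈))

⟦_⟧ : ∀ {P : Fin n → Set} → Decidable P → Subset n
⟦ P? ⟧ = tabulate (does ∘ P?)

x∈⟦P?⟧⇔Px : ∀ {x} {P : Fin n → Set} {P? : Decidable P} → x ∈ ⟦ P? ⟧ ⇔ P x
x∈⟦P?⟧⇔Px {x = x} {P? = P?} = mk⇔
  (λ x∈ → toWitness (Equivalence.from T-≡ (trans (isYes≗does (P? x)) (Equivalence.to x∈tabulate⇔ x∈))))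
  (λ Px → Equivalence.from x∈tabulate⇔ (dec-true (P? x) Px))

preimage-∁ : ∀ (f : Fin n → Fin n) (p : Subset n) → preimage f (∁ p) ≡ ∁ (preimage f p)
preimage-∁ f p = trans (tabulate-cong λ x → lookup-map (f x) not p) (tabulate-∘ not (lookup p ∘ f))

∣preimage∣≡∣p∣ : ∀ (π : Permutation′ n) (p : Subset n) → ∣ preimage (π ⟨$⟩ʳ_) p ∣ ≡ ∣ p ∣
∣preimage∣≡∣p∣ π p = begin
  ∣ preimage π⟨$⟩ p ∣                  ≡⟨ ∣p∣≡sum (preimage π⟨$⟩ p) ⟩
  sum (indicator ∘ lookup (preimage π⟨$⟩ p))
    ≡⟨ sum-cong-≗ (cong indicator ∘ lookup∘tabulate (lookup p ∘ π⟨$⟩)) ⟩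
  sum (indicator ∘ lookup p ∘ π⟨$⟩)    ≡⟨ sum-permute (indicator ∘ lookup p) π ⟨
  sum (indicator ∘ lookup p)           ≡⟨ ∣p∣≡sum p ⟨
  ∣ p ∣                                ∎
  where
  open ≡-Reasoning
  open Sum +-0-commutativeMonoid using (sum; sum-permute; sum-cong-≗)
  π⟨$⟩ = π ⟨$⟩ʳ_
  indicator : Bool → ℕ
  indicator b = if b then 1 else 0
  ∣p∣≡sum : ∀ {m} (q : Subset m) → ∣ q ∣ ≡ sum (indicator ∘ lookup q)
  ∣p∣≡sum [] = refl
  ∣p∣≡sum (inside ∷ q) = cong suc (∣p∣≡sum q)
  ∣p∣≡sum (outside ∷ q) = ∣p∣≡sum q

¬2∣1 : ¬ 2 ∣ 1
¬2∣1 2∣1 = contradiction (∣1⇒≡1 2∣1) λ ()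

2∣m⇒2∣2+m : ∀ {m} → 2 ∣ m → 2 ∣ 2 + m
2∣m⇒2∣2+m = ∣m∣n⇒∣m+n ∣-refl

2∣2+m⇒2∣m : ∀ {m} → 2 ∣ 2 + m → 2 ∣ m
2∣2+m⇒2∣m 2∣2+m = ∣m+n∣m⇒∣n 2∣2+m ∣-refl

¬2∣1+m⇒2∣m : ∀ {m} → ¬ 2 ∣ suc m → 2 ∣ m
¬2∣1+m⇒2∣m {zero} _ = 2 ∣0
¬2∣1+m⇒2∣m {suc zero} ¬2∣2 = contradiction ∣-refl ¬2∣2
¬2∣1+m⇒2∣m {suc (suc m)} ¬2∣3+m = 2∣m⇒2∣2+m (¬2∣1+m⇒2∣m (¬2∣3+m ∘ 2∣m⇒2∣2+m))

2∣1+m⇒¬2∣m : ∀ {m} → 2 ∣ suc m → ¬ 2 ∣ m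
2∣1+m⇒¬2∣m {m} 2∣1+m 2∣m = ¬2∣1 (∣m+n∣m⇒∣n (subst (2 ∣_) (+-comm 1 m) 2∣1+m) 2∣m)

-- Subsets closed under an involution

module InvolutionClosed {n : ℕ} (ι : Fin n → Fin n) (ι-involutive : ∀ x → ι (ι x) ≡ x) where

  Closed : Subset n → Set
  Closed P = ∀ x → x ∈ P → ι x ∈ P

  HasFixedPoint : Subset n → Set
  HasFixedPoint P = ∃ λ x → x ∈ P × ι x ≡ x

  ClosedSubsetOfSize : Subset n → ℕ → Set
  ClosedSubsetOfSize P k = ∃ λ Q → Q ⊆ P × Closed Q × ∣ Q ∣ ≡ k

  orbit : Fin n → Subset n
  orbit x = ⁅ x ⁆ ∪ ⁅ ι x ⁆

  private
    variable
      P Q : Subset n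
      x : Fin n

  ∪-closed : Closed P → Closed Q → Closed (P ∪ Q)
  ∪-closed {P} {Q} P-closed Q-closed x x∈P∪Q with x∈p∪q⁻ P Q x∈P∪Q
  ... | inj₁ x∈P = x∈p∪q⁺ (inj₁ (P-closed x x∈P))
  ... | inj₂ x∈Q = x∈p∪q⁺ (inj₂ (Q-closed x x∈Q))

  ─-closed : Closed P → Closed Q → Closed (P ─ Q)
  ─-closed {P} {Q} P-closed Q-closed x x∈P─Q with x∈p─q⁻ P Q x∈P─Q
  ... | x∈P , x∉Q = x∈p∧x∉q⇒x∈p─q (P-closed x x∈P)
                      λ ιx∈Q → x∉Q (subst (_∈ Q) (ι-involutive x) (Q-closed (ι x) ιx∈Q))

  ∁-closed : Closed P → Closed (∁ P)
  ∁-closed {P} P-closed x x∈∁P =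
    x∉p⇒x∈∁p λ ιx∈P → x∈∁p⇒x∉p x∈∁P (subst (_∈ P) (ι-involutive x) (P-closed (ι x) ιx∈P))

  ⁅fixedPoint⁆-closed : ι x ≡ x → Closed ⁅ x ⁆
  ⁅fixedPoint⁆-closed {x} ιx≡x z z∈⁅x⁆ =
    subst (λ w → ι w ∈ ⁅ x ⁆) (sym (x∈⁅y⁆⇒x≡y x z∈⁅x⁆)) (subst (_∈ ⁅ x ⁆) (sym ιx≡x) (x∈⁅x⁆ x))

  orbit-closed : Closed (orbit x)
  orbit-closed {x} z z∈orbit with x∈p∪q⁻ ⁅ x ⁆ ⁅ ι x ⁆ z∈orbit
  ... | inj₁ z∈⁅x⁆ = x∈p∪q⁺ (inj₂ (subst (λ w → ι w ∈ ⁅ ι x ⁆) (sym (x∈⁅y⁆⇒x≡y x z∈⁅x⁆)) (x∈⁅x⁆ (ι x))))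
  ... | inj₂ z∈⁅ιx⁆ = x∈p∪q⁺ (inj₁ (subst (λ w → ι w ∈ ⁅ x ⁆) (sym (x∈⁅y⁆⇒x≡y (ι x) z∈⁅ιx⁆))
                                       (subst (_∈ ⁅ x ⁆) (sym (ι-involutive x)) (x∈⁅x⁆ x))))

  orbit⊆ : Closed P → x ∈ P → orbit x ⊆ P
  orbit⊆ {P} {x} P-closed x∈P {z} z∈orbit with x∈p∪q⁻ ⁅ x ⁆ ⁅ ι x ⁆ z∈orbit
  ... | inj₁ z∈⁅x⁆ = subst (_∈ P) (sym (x∈⁅y⁆⇒x≡y x z∈⁅x⁆)) x∈P
  ... | inj₂ z∈⁅ιx⁆ = subst (_∈ P) (sym (x∈⁅y⁆⇒x≡y (ι x) z∈⁅ιx⁆)) (P-closed x x∈P)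

  ∣orbit∣-fixed : ι x ≡ x → ∣ orbit x ∣ ≡ 1
  ∣orbit∣-fixed {x} ιx≡x = begin
    ∣ ⁅ x ⁆ ∪ ⁅ ι x ⁆ ∣ ≡⟨ cong (λ y → ∣ ⁅ x ⁆ ∪ ⁅ y ⁆ ∣) ιx≡x ⟩
    ∣ ⁅ x ⁆ ∪ ⁅ x ⁆ ∣   ≡⟨ cong ∣_∣ (∪-idem ⁅ x ⁆) ⟩
    ∣ ⁅ x ⁆ ∣           ≡⟨ ∣⁅x⁆∣≡1 x ⟩
    1                   ∎
    where open ≡-Reasoning

  ∣orbit∣-free : ι x ≢ x → ∣ orbit x ∣ ≡ 2
  ∣orbit∣-free {x} ιx≢x =
    trans (∣p∪q∣≡∣p∣+∣q∣ ⁅ x ⁆ ⁅ ι x ⁆ disjoint) (cong₂ _+_ (∣⁅x⁆∣≡1 x) (∣⁅x⁆∣≡1 (ι x)))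
    where
    disjoint : ∀ {z} → z ∈ ⁅ x ⁆ → z ∉ ⁅ ι x ⁆
    disjoint {z} z∈⁅x⁆ z∈⁅ιx⁆ = ιx≢x (trans (sym (x∈⁅y⁆⇒x≡y (ι x) z∈⁅ιx⁆)) (x∈⁅y⁆⇒x≡y x z∈⁅x⁆))

  ∣P∣≡1+∣P─orbit∣ : Closed P → x ∈ P → ι x ≡ x → ∣ P ∣ ≡ 1 + ∣ P ─ orbit x ∣
  ∣P∣≡1+∣P─orbit∣ {P} {x} P-closed x∈P ιx≡x =
    trans (q⊆p⇒∣p∣≡∣q∣+∣p─q∣ (orbit⊆ P-closed x∈P)) (cong (_+ ∣ P ─ orbit x ∣) (∣orbit∣-fixed ιx≡x))

  ∣P∣≡2+∣P─orbit∣ : Closed P → x ∈ P → ι x ≢ x → ∣ P ∣ ≡ 2 + ∣ P ─ orbit x ∣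
  ∣P∣≡2+∣P─orbit∣ {P} {x} P-closed x∈P ιx≢x =
    trans (q⊆p⇒∣p∣≡∣q∣+∣p─q∣ (orbit⊆ P-closed x∈P)) (cong (_+ ∣ P ─ orbit x ∣) (∣orbit∣-free ιx≢x))

  ∣P─orbit∣<∣P∣ : x ∈ P → ∣ P ─ orbit x ∣ < ∣ P ∣
  ∣P─orbit∣<∣P∣ {x} {P} x∈P = p∩q≢∅⇒∣p─q∣<∣p∣ P (orbit x) (x , x∈p∩q⁺ (x∈P , x∈p∪q⁺ (inj₁ (x∈⁅x⁆ x))))

  fromDifference : ∀ {k} R → ClosedSubsetOfSize (P ─ R) k → ClosedSubsetOfSize P k
  fromDifference {P} R (Q , Q⊆P─R , Q-closed , ∣Q∣≡k) = Q , p─q⊆p P R ∘ Q⊆P─R , Q-closed , ∣Q∣≡k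

  addOrbit : ∀ {k m} → Closed P → x ∈ P → ∣ orbit x ∣ ≡ m →
             ClosedSubsetOfSize (P ─ orbit x) k → ClosedSubsetOfSize P (m + k)
  addOrbit {P} {x} P-closed x∈P refl (Q , Q⊆P─O , Q-closed , refl) =
    orbit x ∪ Q , O∪Q⊆P , ∪-closed orbit-closed Q-closed , ∣p∪q∣≡∣p∣+∣q∣ (orbit x) Q disjoint
    where
    disjoint : ∀ {z} → z ∈ orbit x → z ∉ Q
    disjoint z∈O z∈Q = proj₂ (x∈p─q⁻ P (orbit x) (Q⊆P─O z∈Q)) z∈O
    O∪Q⊆P : orbit x ∪ Q ⊆ P
    O∪Q⊆P z∈O∪Q with x∈p∪q⁻ (orbit x) Q z∈O∪Q
    ... | inj₁ z∈O = orbit⊆ P-closed x∈P z∈O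
    ... | inj₂ z∈Q = p─q⊆p P (orbit x) (Q⊆P─O z∈Q)

  odd⇒HasFixedPoint : Closed P → ¬ 2 ∣ ∣ P ∣ → HasFixedPoint P
  odd⇒HasFixedPoint {P} = go P (<-wellFounded ∣ P ∣)
    where
    go : ∀ P → Acc _<_ ∣ P ∣ → Closed P → ¬ 2 ∣ ∣ P ∣ → HasFixedPoint P
    go P (acc smaller) P-closed odd
      with 0<∣p∣⇒Nonempty (n≢0⇒n>0 λ ∣P∣≡0 → odd (subst (2 ∣_) (sym ∣P∣≡0) (2 ∣0)))
    ... | x , x∈P with ι x ≟ x
    ... | yes ιx≡x = x , x∈P , ιx≡x
    ... | no ιx≢x
      with ∣P∣≡2+∣P─O∣ ← ∣P∣≡2+∣P─orbit∣ P-closed x∈P ιx≢x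
      with go (P ─ orbit x) (smaller (∣P─orbit∣<∣P∣ x∈P))
              (─-closed P-closed orbit-closed) (odd ∘ subst (2 ∣_) (sym ∣P∣≡2+∣P─O∣) ∘ 2∣m⇒2∣2+m)
    ... | z , z∈P─O , ιz≡z = z , p─q⊆p P (orbit x) z∈P─O , ιz≡z

  evenClosedSubset : ∀ {k} → Closed P → 2 ∣ k → k ≤ ∣ P ∣ → ClosedSubsetOfSize P k
  evenClosedSubset {P} = go P (<-wellFounded ∣ P ∣)
    where
    go : ∀ P {k} → Acc _<_ ∣ P ∣ → Closed P → 2 ∣ k → k ≤ ∣ P ∣ → ClosedSubsetOfSize P k
    go P {zero} _ _ _ _ = ⊥ , ⊥⊆ , (λ _ x∈⊥ → contradiction x∈⊥ ∉⊥) , ∣⊥∣≡0 n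
    go P {suc zero} _ _ 2∣1 _ = contradiction 2∣1 ¬2∣1
    go P {suc (suc k)} (acc smaller) P-closed 2∣2+k 2+k≤∣P∣
      with 0<∣p∣⇒Nonempty (≤-trans (s≤s z≤n) 2+k≤∣P∣)
    ... | x , x∈P with ι x ≟ x
    ... | no ιx≢x
      with ∣P∣≡2+∣P─O∣ ← ∣P∣≡2+∣P─orbit∣ P-closed x∈P ιx≢x
      = addOrbit P-closed x∈P (∣orbit∣-free ιx≢x)
          (go (P ─ orbit x) (smaller (∣P─orbit∣<∣P∣ x∈P))
              (─-closed P-closed orbit-closed) (2∣2+m⇒2∣m 2∣2+k)
              (≤-pred (≤-pred (subst (2 + k ≤_) ∣P∣≡2+∣P─O∣ 2+k≤∣P∣))))
    ... | yes ιx≡x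
      with ∣P∣≡1+∣P─O∣ ← ∣P∣≡1+∣P─orbit∣ P-closed x∈P ιx≡x
      with 2 + k ≤? ∣ P ─ orbit x ∣
    ... | yes 2+k≤∣P─O∣ =
      fromDifference (orbit x) (go (P ─ orbit x) (smaller (∣P─orbit∣<∣P∣ x∈P))
                             (─-closed P-closed orbit-closed) 2∣2+k 2+k≤∣P─O∣)
    ... | no 2+k≰∣P─O∣ =
      P , (λ x∈P → x∈P) , P-closed ,
      ≤-antisym (subst (_≤ 2 + k) (sym ∣P∣≡1+∣P─O∣) (≰⇒> 2+k≰∣P─O∣)) 2+k≤∣P∣

  closedSubsetOfSize : ∀ {k} → Closed P → k ≤ ∣ P ∣ → 2 ∣ k ⊎ HasFixedPoint P → ClosedSubsetOfSize P k
  closedSubsetOfSize P-closed k≤∣P∣ (inj₁ 2∣k) = evenClosedSubset P-closed 2∣k k≤∣P∣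
  closedSubsetOfSize {k = zero} P-closed k≤∣P∣ (inj₂ _) = evenClosedSubset P-closed (2 ∣0) k≤∣P∣
  closedSubsetOfSize {P} {suc k} P-closed 1+k≤∣P∣ (inj₂ (z , z∈P , ιz≡z)) with 2 ∣? suc k
  ... | yes 2∣1+k = evenClosedSubset P-closed 2∣1+k 1+k≤∣P∣
  ... | no ¬2∣1+k =
    addOrbit P-closed z∈P (∣orbit∣-fixed ιz≡z)
      (evenClosedSubset (─-closed P-closed orbit-closed) (¬2∣1+m⇒2∣m ¬2∣1+k)
        (≤-pred (subst (suc k ≤_) (∣P∣≡1+∣P─orbit∣ P-closed z∈P ιz≡z) 1+k≤∣P∣)))

-- Subgroups as regular sets of Cayley graphs

module _ (G : FinGroup) where
  open FinGroup G

  private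
    group : Group 0ℓ 0ℓ
    group = record { isGroup = isGroup }

    variable
      B H T X : Subset order

  open Group group using (assoc; identityˡ; identityʳ)
  open import Algebra.Properties.Group group
    using ( ⁻¹-involutive; ⁻¹-anti-homo-∙; ε⁻¹≈ε; inverseˡ-unique; x∙y⁻¹≈ε⇒x≈y
          ; //-rightDividesˡ; //-rightDividesʳ; \\-leftDividesʳ)
  open InvolutionClosed _⁻¹ ⁻¹-involutive public renaming (Closed to InverseClosed)

  -- X / g is the right translate X g⁻¹ = {c ∣ c ∙ g ∈ X}; thus nbrsIn S C x ≡ ∣ C ∩ S / x ⁻¹ ∣.
  infixl 7.5 _/_
  _/_ : Subset order → Fin order → Subset order
  X / g = preimage (_∙ g) X

  ∣X/g∣≡∣X∣ : ∀ X g → ∣ X / g ∣ ≡ ∣ X ∣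
  ∣X/g∣≡∣X∣ X g = ∣preimage∣≡∣p∣ (permutation (_∙ g) (_∙ g ⁻¹) (//-rightDividesˡ g) (//-rightDividesʳ g)) X

  c∈H∩X/g⁺ : ∀ {c g} → c ∈ H → c ∙ g ∈ X → c ∈ H ∩ X / g
  c∈H∩X/g⁺ c∈H cg∈X = x∈p∩q⁺ (c∈H , Equivalence.from x∈preimage⇔ cg∈X)

  c∈H∩X/g⁻ : ∀ {c g} → c ∈ H ∩ X / g → c ∈ H × c ∙ g ∈ X
  c∈H∩X/g⁻ {H = H} {X} {g = g} c∈ with x∈p∩q⁻ H (X / g) c∈
  ... | c∈H , c∈X/g = c∈H , Equivalence.to x∈preimage⇔ c∈X/g

  infix 4 _∼[_]_
  _∼[_]_ : Fin order → Subset order → Fin order → Set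
  x ∼[ H ] y = x ∙ y ⁻¹ ∈ H

  module Subgroup (H≤G : IsSubgroup G H) where

    ε∈H : ε ∈ H
    ε∈H = proj₁ H≤G

    ∙-closed : ∀ {x y} → x ∈ H → y ∈ H → x ∙ y ∈ H
    ∙-closed = proj₁ (proj₂ H≤G) _ _

    ⁻¹-closed : InverseClosed H
    ⁻¹-closed = proj₂ (proj₂ H≤G)

    ∉⇒⁻¹∉ : ∀ {g} → g ∉ H → g ⁻¹ ∉ H
    ∉⇒⁻¹∉ {g} g∉H g⁻¹∈H = g∉H (subst (_∈ H) (⁻¹-involutive g) (⁻¹-closed (g ⁻¹) g⁻¹∈H))

    x∙y∈H∧y∈H⇒x∈H : ∀ {x y} → x ∙ y ∈ H → y ∈ H → x ∈ H
    x∙y∈H∧y∈H⇒x∈H {x} {y} xy∈H y∈H = subst (_∈ H) (//-rightDividesʳ y x) (∙-closed xy∈H (⁻¹-closed y y∈H))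

    c∈H∧g∉H⇒c∙g∉H : ∀ {c g} → c ∈ H → g ∉ H → c ∙ g ∉ H
    c∈H∧g∉H⇒c∙g∉H {c} {g} c∈H g∉H cg∈H =
      g∉H (subst (_∈ H) (\\-leftDividesʳ c g) (∙-closed (⁻¹-closed c c∈H) cg∈H))

    ∼-sym : ∀ {x y} → x ∼[ H ] y → y ∼[ H ] x
    ∼-sym {x} {y} x∼y = subst (_∈ H) (begin
      (x ∙ y ⁻¹) ⁻¹     ≡⟨ ⁻¹-anti-homo-∙ x (y ⁻¹) ⟩
      y ⁻¹ ⁻¹ ∙ x ⁻¹    ≡⟨ cong (_∙ x ⁻¹) (⁻¹-involutive y) ⟩
      y ∙ x ⁻¹          ∎) (⁻¹-closed _ x∼y)
      where open ≡-Reasoning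

    ∼-trans : ∀ {x y z} → x ∼[ H ] y → y ∼[ H ] z → x ∼[ H ] z
    ∼-trans {x} {y} {z} x∼y y∼z = subst (_∈ H) (begin
      x ∙ y ⁻¹ ∙ (y ∙ z ⁻¹)   ≡⟨ assoc x (y ⁻¹) (y ∙ z ⁻¹) ⟩
      x ∙ (y ⁻¹ ∙ (y ∙ z ⁻¹)) ≡⟨ cong (x ∙_) (\\-leftDividesʳ y (z ⁻¹)) ⟩
      x ∙ z ⁻¹                ∎) (∙-closed x∼y y∼z)
      where open ≡-Reasoning

    c∈H⇒c∙g∼g : ∀ {c g} → c ∈ H → c ∙ g ∼[ H ] g
    c∈H⇒c∙g∼g {c} {g} c∈H = subst (_∈ H) (sym (//-rightDividesʳ g c)) c∈H

    H-ε-closed : InverseClosed (H - ε)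
    H-ε-closed = ─-closed ⁻¹-closed (⁅fixedPoint⁆-closed ε⁻¹≈ε)

    ∣H∣≡1+∣H-ε∣ : ∣ H ∣ ≡ suc ∣ H - ε ∣
    ∣H∣≡1+∣H-ε∣ = x∈p⇒∣p∣≡1+∣p-x∣ ε∈H

    even⇒HasInvolution : 2 ∣ ∣ H ∣ → HasFixedPoint (H - ε)
    even⇒HasInvolution 2∣∣H∣ = odd⇒HasFixedPoint H-ε-closed (2∣1+m⇒¬2∣m (subst (2 ∣_) ∣H∣≡1+∣H-ε∣ 2∣∣H∣))

  ∩-isSubgroup : IsSubgroup G H → IsSubgroup G X → IsSubgroup G (H ∩ X)
  ∩-isSubgroup {H = H} {X = X} H≤G X≤G =
    x∈p∩q⁺ (H.ε∈H , X.ε∈H) ,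
    (λ x y x∈ y∈ → let x∈H , x∈X = x∈p∩q⁻ H X x∈ ; y∈H , y∈X = x∈p∩q⁻ H X y∈
                   in x∈p∩q⁺ (H.∙-closed x∈H y∈H , X.∙-closed x∈X y∈X)) ,
    (λ x x∈ → let x∈H , x∈X = x∈p∩q⁻ H X x∈ in x∈p∩q⁺ (H.⁻¹-closed x x∈H , X.⁻¹-closed x x∈X))
    where
    module H = Subgroup H≤G
    module X = Subgroup X≤G

  record Transversal (H T : Subset order) : Set where
    field
      inverseClosed : InverseClosed T
      covers        : ∀ {g} → g ∉ H → ∃ λ t → t ∈ T × t ∼[ H ] g
      atMostOnce    : ∀ {t t′} → t ∈ T → t′ ∈ T → t ∼[ H ] t′ → t ≡ t′

  module _ {S} (H≤G : IsSubgroup G H) (S-connection : IsConnectionSet G S) where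
    open Subgroup H≤G

    ∣H∩S/g∣≡1 : ∀ {a} → IsRegularSetIn G S a 1 H → ∀ {g} → g ∉ H → ∣ H ∩ S / g ∣ ≡ 1
    ∣H∩S/g∣≡1 (_ , _ , _ , outside≡1) {g} g∉H =
      subst (λ w → ∣ H ∩ S / w ∣ ≡ 1) (⁻¹-involutive g) (outside≡1 (g ⁻¹) (∉⇒⁻¹∉ g∉H))

    regular⇒transversal : ∀ {a} → IsRegularSetIn G S a 1 H → Transversal H (S ─ H)
    regular⇒transversal S-regular = record
      { inverseClosed = ─-closed (proj₂ S-connection) ⁻¹-closed
      ; covers = covers
      ; atMostOnce = atMostOnce
      }
      where
      covers : ∀ {g} → g ∉ H → ∃ λ t → t ∈ S ─ H × t ∼[ H ] g
      covers {g} g∉H with 0<∣p∣⇒Nonempty (subst (0 <_) (sym (∣H∩S/g∣≡1 S-regular g∉H)) z<s)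
      ... | c , c∈H∩S/g with c∈H∩X/g⁻ {X = S} c∈H∩S/g
      ... | c∈H , cg∈S = c ∙ g , x∈p∧x∉q⇒x∈p─q cg∈S (c∈H∧g∉H⇒c∙g∉H c∈H g∉H) , c∈H⇒c∙g∼g c∈H
      atMostOnce : ∀ {t t′} → t ∈ S ─ H → t′ ∈ S ─ H → t ∼[ H ] t′ → t ≡ t′
      atMostOnce {t} {t′} t∈S─H t′∈S─H t∼t′ =
        x∙y⁻¹≈ε⇒x≈y t t′ (∣p∣≡1⇒x∈p⇒y∈p⇒x≡y (∣H∩S/g∣≡1 S-regular t′∉H) tt′⁻¹∈ ε∈)
        where
        t∈S = proj₁ (x∈p─q⁻ S H t∈S─H)
        t′∈S = proj₁ (x∈p─q⁻ S H t′∈S─H)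
        t′∉H = proj₂ (x∈p─q⁻ S H t′∈S─H)
        tt′⁻¹∈ : t ∙ t′ ⁻¹ ∈ H ∩ S / t′
        tt′⁻¹∈ = c∈H∩X/g⁺ t∼t′ (subst (_∈ S) (sym (//-rightDividesˡ t′ t)) t∈S)
        ε∈ : ε ∈ H ∩ S / t′
        ε∈ = c∈H∩X/g⁺ ε∈H (subst (_∈ S) (sym (identityˡ t′)) t′∈S)

    -- The unique neighbour of ε in H is an involution.
    totalPerfectCode⇒HasFixedPoint : ∀ {b} → IsRegularSetIn G S 1 b H → HasFixedPoint (H - ε)
    totalPerfectCode⇒HasFixedPoint (_ , _ , inside≡1 , _)
      with 0<∣p∣⇒Nonempty (subst (0 <_) (sym (inside≡1 ε ε∈H)) z<s)
    ... | s , s∈H∩S/ε⁻¹ = s , x∈p∧x≢y⇒x∈p-y s∈H s≢ε , s⁻¹≡s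
      where
      ∙ε⁻¹ : ∀ x → x ∙ ε ⁻¹ ≡ x
      ∙ε⁻¹ x = trans (cong (x ∙_) ε⁻¹≈ε) (identityʳ x)
      s∈H = proj₁ (c∈H∩X/g⁻ {X = S} s∈H∩S/ε⁻¹)
      s∈S = subst (_∈ S) (∙ε⁻¹ s) (proj₂ (c∈H∩X/g⁻ {X = S} s∈H∩S/ε⁻¹))
      s≢ε : s ≢ ε
      s≢ε s≡ε = proj₁ S-connection (subst (_∈ S) s≡ε s∈S)
      s⁻¹≡s : s ⁻¹ ≡ s
      s⁻¹≡s = ∣p∣≡1⇒x∈p⇒y∈p⇒x≡y (inside≡1 ε ε∈H)
        (c∈H∩X/g⁺ (⁻¹-closed s s∈H) (subst (_∈ S) (sym (∙ε⁻¹ (s ⁻¹))) (proj₂ S-connection s s∈S)))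
        s∈H∩S/ε⁻¹

  ConjugationClosed : Subset order → Set
  ConjugationClosed B = ∀ g β → β ∈ B → g ⁻¹ ∙ β ∙ g ∈ B

  -- B ⋆ T = {β ∙ t ∣ β ∈ B, t ∈ T}
  infixl 7 _⋆_
  _⋆_ : Subset order → Subset order → Subset order
  B ⋆ T = ⟦ (λ z → any? λ t → t ∈? T ×-dec z ∙ t ⁻¹ ∈? B) ⟧

  z∈B⋆T⇔ : ∀ {z} → z ∈ B ⋆ T ⇔ ∃ λ t → t ∈ T × z ∙ t ⁻¹ ∈ B
  z∈B⋆T⇔ {B} {T} = x∈⟦P?⟧⇔Px {P? = λ z → any? λ t → t ∈? T ×-dec z ∙ t ⁻¹ ∈? B}

  ⋆-inverseClosed : InverseClosed B → ConjugationClosed B → InverseClosed T → InverseClosed (B ⋆ T)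
  ⋆-inverseClosed {B} {T} B-closed B-conj T-closed z z∈B⋆T
    with Equivalence.to (z∈B⋆T⇔ {B} {T}) z∈B⋆T
  ... | t , t∈T , zt⁻¹∈B =
    Equivalence.from (z∈B⋆T⇔ {B} {T}) (t ⁻¹ , T-closed t t∈T , subst (_∈ B) conjugate≡
      (B-conj t ((z ∙ t ⁻¹) ⁻¹) (B-closed (z ∙ t ⁻¹) zt⁻¹∈B)))
    where
    open ≡-Reasoning
    conjugate≡ : t ⁻¹ ∙ (z ∙ t ⁻¹) ⁻¹ ∙ t ≡ z ⁻¹ ∙ t ⁻¹ ⁻¹
    conjugate≡ = begin
      t ⁻¹ ∙ (z ∙ t ⁻¹) ⁻¹ ∙ t      ≡⟨ cong (λ w → t ⁻¹ ∙ w ∙ t) (⁻¹-anti-homo-∙ z (t ⁻¹)) ⟩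
      t ⁻¹ ∙ (t ⁻¹ ⁻¹ ∙ z ⁻¹) ∙ t   ≡⟨ cong (λ w → t ⁻¹ ∙ (w ∙ z ⁻¹) ∙ t) (⁻¹-involutive t) ⟩
      t ⁻¹ ∙ (t ∙ z ⁻¹) ∙ t         ≡⟨ cong (_∙ t) (\\-leftDividesʳ t (z ⁻¹)) ⟩
      z ⁻¹ ∙ t                      ≡⟨ cong (z ⁻¹ ∙_) (⁻¹-involutive t) ⟨
      z ⁻¹ ∙ t ⁻¹ ⁻¹                ∎

  -- If c ∙ g = β ∙ t′ with c, β ∈ H, then t′ represents H g, so t′ = t;
  -- hence H ∩ (B ⋆ T) / g = B / (g ∙ t ⁻¹).
  ∣H∩B⋆T/g∣≡∣B∣ : IsSubgroup G H → Transversal H T → B ⊆ H → ∀ {g} → g ∉ H → ∣ H ∩ (B ⋆ T) / g ∣ ≡ ∣ B ∣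
  ∣H∩B⋆T/g∣≡∣B∣ {H} {T} {B} H≤G T-transversal B⊆H {g} g∉H with Transversal.covers T-transversal g∉H
  ... | t , t∈T , t∼g = trans (cong ∣_∣ H∩B⋆T/g≡B/k) (∣X/g∣≡∣X∣ B k)
    where
    open Subgroup H≤G
    open Transversal T-transversal
    k = g ∙ t ⁻¹
    k∈H : k ∈ H
    k∈H = ∼-sym t∼g
    c∙g∙t⁻¹≡c∙k : ∀ c → c ∙ g ∙ t ⁻¹ ≡ c ∙ k
    c∙g∙t⁻¹≡c∙k c = assoc c g (t ⁻¹)
    H∩B⋆T/g≡B/k : H ∩ (B ⋆ T) / g ≡ B / k
    H∩B⋆T/g≡B/k = ⊆-antisym ⊆B/k ⊆H∩B⋆T/g
      where
      ⊆B/k : H ∩ (B ⋆ T) / g ⊆ B / k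
      ⊆B/k {c} c∈ with c∈H∩X/g⁻ {X = B ⋆ T} c∈
      ... | c∈H , cg∈B⋆T with Equivalence.to (z∈B⋆T⇔ {B} {T}) cg∈B⋆T
      ... | t′ , t′∈T , cgt′⁻¹∈B
        with atMostOnce t′∈T t∈T (∼-trans (∼-sym (B⊆H cgt′⁻¹∈B)) (∼-trans (c∈H⇒c∙g∼g c∈H) k∈H))
      ... | refl = Equivalence.from x∈preimage⇔ (subst (_∈ B) (c∙g∙t⁻¹≡c∙k c) cgt′⁻¹∈B)
      ⊆H∩B⋆T/g : B / k ⊆ H ∩ (B ⋆ T) / g
      ⊆H∩B⋆T/g {c} c∈B/k = c∈H∩X/g⁺ (x∙y∈H∧y∈H⇒x∈H (B⊆H ck∈B) k∈H)
        (Equivalence.from (z∈B⋆T⇔ {B} {T}) (t , t∈T , subst (_∈ B) (sym (c∙g∙t⁻¹≡c∙k c)) ck∈B))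
        where
        ck∈B : c ∙ k ∈ B
        ck∈B = Equivalence.to x∈preimage⇔ c∈B/k

  OuterConnectionSet : Subset order → ℕ → Set
  OuterConnectionSet H b = ∃ λ S → InverseClosed S × (∀ {g} → g ∉ H → ∣ H ∩ S / g ∣ ≡ b)

  ∁-outerConnectionSet : ∀ {b} → OuterConnectionSet H b → OuterConnectionSet H (∣ H ∣ ∸ b)
  ∁-outerConnectionSet {H} {b} (S , S-closed , ∣H∩S/g∣≡b) = ∁ S , ∁-closed S-closed , λ {g} g∉H → begin
    ∣ H ∩ ∁ S / g ∣         ≡⟨ cong (λ X → ∣ H ∩ X ∣) (preimage-∁ (_∙ g) S) ⟩
    ∣ H ∩ ∁ (S / g) ∣       ≡⟨ ∣p∩∁q∣≡∣p∣∸∣p∩q∣ H (S / g) ⟩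
    ∣ H ∣ ∸ ∣ H ∩ S / g ∣   ≡⟨ cong (∣ H ∣ ∸_) (∣H∩S/g∣≡b g∉H) ⟩
    ∣ H ∣ ∸ b               ∎
    where open ≡-Reasoning

  regularSetFromParts : ∀ {a b} → IsSubgroup G H → (∃ λ v → v ∉ H) →
                        ClosedSubsetOfSize (H - ε) a → OuterConnectionSet H b → IsRegularSetOf G a b H
  regularSetFromParts {H} H≤G (v , v∉H) (S₁ , S₁⊆H-ε , S₁-closed , refl)
                      (S₂ , S₂-closed , ∣H∩S₂/g∣≡b) =
    S , (ε∉S , ∪-closed S₁-closed (─-closed S₂-closed ⁻¹-closed)) , (ε , ε∈H) , (v , v∉H) ,
    (λ x x∈H → trans (cong ∣_∣ (H∩S/g≡S₁/g (⁻¹-closed x x∈H))) (∣X/g∣≡∣X∣ S₁ (x ⁻¹))) ,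
    (λ x x∉H → trans (cong ∣_∣ (H∩S/g≡H∩S₂/g (∉⇒⁻¹∉ x∉H))) (∣H∩S₂/g∣≡b (∉⇒⁻¹∉ x∉H)))
    where
    open Subgroup H≤G
    S = S₁ ∪ (S₂ ─ H)
    S₁⊆H : S₁ ⊆ H
    S₁⊆H = p─q⊆p H ⁅ ε ⁆ ∘ S₁⊆H-ε
    ε∉S : ε ∉ S
    ε∉S ε∈S with x∈p∪q⁻ S₁ (S₂ ─ H) ε∈S
    ... | inj₁ ε∈S₁ = proj₂ (x∈p─q⁻ H ⁅ ε ⁆ (S₁⊆H-ε ε∈S₁)) (x∈⁅x⁆ ε)
    ... | inj₂ ε∈S₂─H = proj₂ (x∈p─q⁻ S₂ H ε∈S₂─H) ε∈H
    H∩S/g≡S₁/g : ∀ {g} → g ∈ H → H ∩ S / g ≡ S₁ / g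
    H∩S/g≡S₁/g {g} g∈H = ⊆-antisym
      (λ c∈ → let c∈H , cg∈S = c∈H∩X/g⁻ {X = S} c∈ in Equivalence.from x∈preimage⇔
        ([ id , (λ cg∈S₂─H → contradiction (∙-closed c∈H g∈H) (proj₂ (x∈p─q⁻ S₂ H cg∈S₂─H))) ]′
          (x∈p∪q⁻ S₁ (S₂ ─ H) cg∈S)))
      (λ c∈S₁/g → let cg∈S₁ = Equivalence.to x∈preimage⇔ c∈S₁/g in
        c∈H∩X/g⁺ (x∙y∈H∧y∈H⇒x∈H (S₁⊆H cg∈S₁) g∈H) (x∈p∪q⁺ {q = S₂ ─ H} (inj₁ cg∈S₁)))
    H∩S/g≡H∩S₂/g : ∀ {g} → g ∉ H → H ∩ S / g ≡ H ∩ S₂ / g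
    H∩S/g≡H∩S₂/g {g} g∉H = ⊆-antisym
      (λ c∈ → let c∈H , cg∈S = c∈H∩X/g⁻ {X = S} c∈ in c∈H∩X/g⁺ c∈H
        ([ (λ cg∈S₁ → contradiction (S₁⊆H cg∈S₁) (c∈H∧g∉H⇒c∙g∉H c∈H g∉H))
         , (λ cg∈S₂─H → proj₁ (x∈p─q⁻ S₂ H cg∈S₂─H)) ]′
          (x∈p∪q⁻ S₁ (S₂ ─ H) cg∈S)))
      (λ c∈ → let c∈H , cg∈S₂ = c∈H∩X/g⁻ {X = S₂} c∈ in
        c∈H∩X/g⁺ c∈H (x∈p∪q⁺ {p = S₁} (inj₂ (x∈p∧x∉q⇒x∈p─q cg∈S₂ (c∈H∧g∉H⇒c∙g∉H c∈H g∉H)))))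

  conjugate-∙ : ∀ a b x → (a ∙ b) ⁻¹ ∙ x ∙ (a ∙ b) ≡ b ⁻¹ ∙ (a ⁻¹ ∙ x ∙ a) ∙ b
  conjugate-∙ a b x = begin
    (a ∙ b) ⁻¹ ∙ x ∙ (a ∙ b)       ≡⟨ cong (λ w → w ∙ x ∙ (a ∙ b)) (⁻¹-anti-homo-∙ a b) ⟩
    b ⁻¹ ∙ a ⁻¹ ∙ x ∙ (a ∙ b)      ≡⟨ assoc (b ⁻¹ ∙ a ⁻¹ ∙ x) a b ⟨
    b ⁻¹ ∙ a ⁻¹ ∙ x ∙ a ∙ b        ≡⟨ cong (λ w → w ∙ a ∙ b) (assoc (b ⁻¹) (a ⁻¹) x) ⟩
    b ⁻¹ ∙ (a ⁻¹ ∙ x) ∙ a ∙ b      ≡⟨ cong (_∙ b) (assoc (b ⁻¹) (a ⁻¹ ∙ x) a) ⟩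
    b ⁻¹ ∙ (a ⁻¹ ∙ x ∙ a) ∙ b      ∎
    where open ≡-Reasoning

  module GeneralizedDihedral {A} (A-dihedral : IsGeneralizedDihedralWrt G A) where

    private
      A≤G = proj₁ (proj₁ A-dihedral)
      A-comm = proj₂ (proj₁ A-dihedral)
      y = proj₁ (proj₂ A-dihedral)
      y∙y≡ε = proj₁ (proj₂ (proj₂ (proj₂ A-dihedral)))
      y-inverts = proj₁ (proj₂ (proj₂ (proj₂ (proj₂ A-dihedral))))
      A∪Ay = proj₂ (proj₂ (proj₂ (proj₂ (proj₂ A-dihedral))))
      module A = Subgroup A≤G

    conjugate-trivial : ∀ {a x} → a ∈ A → x ∈ A → a ⁻¹ ∙ x ∙ a ≡ x
    conjugate-trivial {a} {x} a∈A x∈A = begin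
      a ⁻¹ ∙ x ∙ a    ≡⟨ assoc (a ⁻¹) x a ⟩
      a ⁻¹ ∙ (x ∙ a)  ≡⟨ cong (a ⁻¹ ∙_) (A-comm x a x∈A a∈A) ⟩
      a ⁻¹ ∙ (a ∙ x)  ≡⟨ \\-leftDividesʳ a x ⟩
      x               ∎
      where open ≡-Reasoning

    conjugate∈A : ∀ g {x} → x ∈ A → g ⁻¹ ∙ x ∙ g ≡ x ⊎ g ⁻¹ ∙ x ∙ g ≡ x ⁻¹
    conjugate∈A g {x} x∈A with A∪Ay g
    ... | inj₁ g∈A = inj₁ (conjugate-trivial g∈A x∈A)
    ... | inj₂ (a , a∈A , refl) = inj₂ (begin
        (a ∙ y) ⁻¹ ∙ x ∙ (a ∙ y)      ≡⟨ conjugate-∙ a y x ⟩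
        y ⁻¹ ∙ (a ⁻¹ ∙ x ∙ a) ∙ y     ≡⟨ cong (λ w → y ⁻¹ ∙ w ∙ y) (conjugate-trivial a∈A x∈A) ⟩
        y ⁻¹ ∙ x ∙ y                  ≡⟨ y-inverts x x∈A ⟩
        x ⁻¹                          ∎)
      where open ≡-Reasoning

    ⊆A⇒conjugationClosed : InverseClosed B → B ⊆ A → ConjugationClosed B
    ⊆A⇒conjugationClosed {B} B-closed B⊆A g β β∈B with conjugate∈A g (B⊆A β∈B)
    ... | inj₁ ≡β = subst (_∈ B) (sym ≡β) β∈B
    ... | inj₂ ≡β⁻¹ = subst (_∈ B) (sym ≡β⁻¹) (B-closed β β∈B)

    ∉A∧∉A⇒∙∈A : ∀ {x z} → x ∉ A → z ∉ A → x ∙ z ∈ A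
    ∉A∧∉A⇒∙∈A {x} {z} x∉A z∉A with A∪Ay x | A∪Ay z
    ... | inj₁ x∈A | _ = contradiction x∈A x∉A
    ... | _ | inj₁ z∈A = contradiction z∈A z∉A
    ... | inj₂ (a , a∈A , refl) | inj₂ (b , b∈A , refl) =
      subst (_∈ A) (sym a∙y∙b∙y≡a∙b⁻¹) (A.∙-closed a∈A (A.⁻¹-closed b b∈A))
      where
      open ≡-Reasoning
      y≡y⁻¹ : y ≡ y ⁻¹
      y≡y⁻¹ = inverseˡ-unique y y y∙y≡ε
      a∙y∙b∙y≡a∙b⁻¹ : a ∙ y ∙ (b ∙ y) ≡ a ∙ b ⁻¹
      a∙y∙b∙y≡a∙b⁻¹ = begin
        a ∙ y ∙ (b ∙ y)       ≡⟨ assoc a y (b ∙ y) ⟩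
        a ∙ (y ∙ (b ∙ y))     ≡⟨ cong (a ∙_) (assoc y b y) ⟨
        a ∙ (y ∙ b ∙ y)       ≡⟨ cong (λ w → a ∙ (w ∙ b ∙ y)) y≡y⁻¹ ⟩
        a ∙ (y ⁻¹ ∙ b ∙ y)    ≡⟨ cong (a ∙_) (y-inverts b b∈A) ⟩
        a ∙ b ⁻¹              ∎

    -- A has index 2, so right multiplication by any h₀ ∈ H ─ A swaps H ∩ A and H ─ A.
    ∣H∣≡∣H∩A∣+∣H∩A∣ : IsSubgroup G H → ∀ {h₀} → h₀ ∈ H ─ A → ∣ H ∣ ≡ ∣ H ∩ A ∣ + ∣ H ∩ A ∣
    ∣H∣≡∣H∩A∣+∣H∩A∣ {H} H≤G {h₀} h₀∈H─A = begin
      ∣ H ∣                           ≡⟨ ∣p∣≡∣p∩q∣+∣p─q∣ H A ⟩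
      ∣ H ∩ A ∣ + ∣ H ─ A ∣           ≡⟨ cong (λ X → ∣ H ∩ A ∣ + ∣ X ∣) H─A≡H∩A/h₀ ⟩
      ∣ H ∩ A ∣ + ∣ (H ∩ A) / h₀ ∣    ≡⟨ cong (∣ H ∩ A ∣ +_) (∣X/g∣≡∣X∣ (H ∩ A) h₀) ⟩
      ∣ H ∩ A ∣ + ∣ H ∩ A ∣           ∎
      where
      open ≡-Reasoning
      open Subgroup H≤G
      h₀∈H = proj₁ (x∈p─q⁻ H A h₀∈H─A)
      h₀∉A = proj₂ (x∈p─q⁻ H A h₀∈H─A)
      H─A≡H∩A/h₀ : H ─ A ≡ (H ∩ A) / h₀
      H─A≡H∩A/h₀ = ⊆-antisym
        (λ {c} c∈H─A → let c∈H , c∉A = x∈p─q⁻ H A c∈H─A in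
          Equivalence.from x∈preimage⇔ (x∈p∩q⁺ (∙-closed c∈H h₀∈H , ∉A∧∉A⇒∙∈A c∉A h₀∉A)))
        (λ {c} c∈H∩A/h₀ → let ch₀∈H , ch₀∈A = x∈p∩q⁻ H A (Equivalence.to x∈preimage⇔ c∈H∩A/h₀) in
          x∈p∧x∉q⇒x∈p─q (x∙y∈H∧y∈H⇒x∈H ch₀∈H h₀∈H)
                        (λ c∈A → A.c∈H∧g∉H⇒c∙g∉H c∈A h₀∉A ch₀∈A))

    outerConnectionSet≤∣H∩A∣ : IsSubgroup G H → Transversal H T → ∀ {b} → b ≤ ∣ H ∩ A ∣ →
                                OuterConnectionSet H b
    outerConnectionSet≤∣H∩A∣ {H} {T} H≤G T-transversal b≤∣K∣
      with closedSubsetOfSize K-closed b≤∣K∣ (inj₂ (ε , ε∈K , ε⁻¹≈ε))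
      where
      open Subgroup (∩-isSubgroup H≤G A≤G) renaming (⁻¹-closed to K-closed; ε∈H to ε∈K)
    ... | B , B⊆K , B-closed , refl =
      B ⋆ T ,
      ⋆-inverseClosed B-closed (⊆A⇒conjugationClosed B-closed (p∩q⊆q H A ∘ B⊆K))
                      (Transversal.inverseClosed T-transversal) ,
      ∣H∩B⋆T/g∣≡∣B∣ H≤G T-transversal (p∩q⊆p H A ∘ B⊆K)

    outerConnectionSet : IsSubgroup G H → Transversal H T → ∀ {b} → b ≤ ∣ H ∣ → OuterConnectionSet H b
    outerConnectionSet {H} H≤G T-transversal {b} b≤∣H∣ with b ≤? ∣ H ∩ A ∣
    ... | yes b≤∣K∣ = outerConnectionSet≤∣H∩A∣ H≤G T-transversal b≤∣K∣
    ... | no b≰∣K∣ with 0<∣p∣⇒Nonempty 0<∣H─A∣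
      where
      0<∣H─A∣ : 0 < ∣ H ─ A ∣
      0<∣H─A∣ = n≢0⇒n>0 λ ∣H─A∣≡0 → b≰∣K∣ (subst (b ≤_)
        (trans (∣p∣≡∣p∩q∣+∣p─q∣ H A) (trans (cong (∣ H ∩ A ∣ +_) ∣H─A∣≡0) (+-identityʳ _))) b≤∣H∣)
    ... | h₀ , h₀∈H─A =
      subst (OuterConnectionSet H) (m∸[m∸n]≡n b≤∣H∣)
        (∁-outerConnectionSet (outerConnectionSet≤∣H∩A∣ H≤G T-transversal ∣H∣∸b≤∣K∣))
      where
      ∣H∣∸b≤∣K∣ : ∣ H ∣ ∸ b ≤ ∣ H ∩ A ∣
      ∣H∣∸b≤∣K∣ = begin
        ∣ H ∣ ∸ b                             ≤⟨ ∸-monoʳ-≤ ∣ H ∣ (<⇒≤ (≰⇒> b≰∣K∣)) ⟩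
        ∣ H ∣ ∸ ∣ H ∩ A ∣                     ≡⟨ cong (_∸ ∣ H ∩ A ∣) (∣H∣≡∣H∩A∣+∣H∩A∣ H≤G h₀∈H─A) ⟩
        ∣ H ∩ A ∣ + ∣ H ∩ A ∣ ∸ ∣ H ∩ A ∣     ≡⟨ m+n∸m≡n ∣ H ∩ A ∣ ∣ H ∩ A ∣ ⟩
        ∣ H ∩ A ∣                             ∎
        where open ≤-Reasoning

    regularSetsFromCode : ∀ {S a₀} → IsSubgroup G H → IsConnectionSet G S → IsRegularSetIn G S a₀ 1 H →
                          ∀ {a b} → a < ∣ H ∣ → b ≤ ∣ H ∣ → 2 ∣ a ⊎ HasFixedPoint (H - ε) →
                          IsRegularSetOf G a b H
    regularSetsFromCode H≤G S-connection S-regular a<∣H∣ b≤∣H∣ 2∣a⊎involution =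
      regularSetFromParts H≤G (proj₁ (proj₂ S-regular))
        (closedSubsetOfSize H-ε-closed (≤-pred (subst (_ <_) ∣H∣≡1+∣H-ε∣ a<∣H∣)) 2∣a⊎involution)
        (outerConnectionSet H≤G (regular⇒transversal H≤G S-connection S-regular) b≤∣H∣)
      where open Subgroup H≤G

theorem1p2 : (G : FinGroup) → IsGeneralizedDihedral G
    → (H : Subset (FinGroup.order G)) → IsSubgroup G H → Nontrivial G H
    → (IsPerfectCodeOf G H ⇔ (∀ a b → a < ∣ H ∣ → b ≤ ∣ H ∣ → (¬ (2 ∣ ∣ H ∣) → 2 ∣ a) → IsRegularSetOf G a b H))
      × (IsTotalPerfectCodeOf G H ⇔ (∀ a b → a < ∣ H ∣ → b ≤ ∣ H ∣ → IsRegularSetOf G a b H))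
theorem1p2 G (A , A-dihedral) H H≤G (h , h∈H , h≢ε) =
  mk⇔ (λ (S , S-connection , S-perfect) _ _ a<∣H∣ b≤∣H∣ odd⇒2∣a →
         regularSetsFromCode H≤G S-connection S-perfect a<∣H∣ b≤∣H∣ (evenOrInvolution odd⇒2∣a))
      (λ regular → regular 0 1 (<-trans z<s 1<∣H∣) (<⇒≤ 1<∣H∣) (λ _ → 2 ∣0)) ,
  mk⇔ (λ (S , S-connection , S-total) _ _ a<∣H∣ b≤∣H∣ →
         regularSetsFromCode H≤G S-connection S-total a<∣H∣ b≤∣H∣
           (inj₂ (totalPerfectCode⇒HasFixedPoint G H≤G S-connection S-total)))
      (λ regular → regular 1 1 1<∣H∣ (<⇒≤ 1<∣H∣))
  where
  open FinGroup G using (ε)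
  open GeneralizedDihedral G A-dihedral
  open Subgroup G H≤G
  1<∣H∣ : 1 < ∣ H ∣
  1<∣H∣ = subst (1 <_) (sym ∣H∣≡1+∣H-ε∣) (s≤s (x∈p⇒0<∣p∣ (x∈p∧x≢y⇒x∈p-y h∈H h≢ε)))
  evenOrInvolution : ∀ {a} → (¬ 2 ∣ ∣ H ∣ → 2 ∣ a) → 2 ∣ a ⊎ HasFixedPoint G (H - ε)
  evenOrInvolution odd⇒2∣a with 2 ∣? ∣ H ∣
  ... | yes 2∣∣H∣ = inj₂ (even⇒HasInvolution 2∣∣H∣)
  ... | no ¬2∣∣H∣ = inj₁ (odd⇒2∣a ¬2∣∣H∣)
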